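{- Let $d \ge 2$ and $k \ge 1$ be integers, let $D = k \cdot 2^d$, and let $A: [D] \times [2^D] \rightarrow \{0,1,\ldots,k\}$ be the $B_D^\top$-based matrix with $k$ row blocks, each of size $2^d$. Then $\mathrm{Pdim}(A) = \mathrm{Pdim}(\dot A) = d$, $\mathrm{Vdim}^*(A) = 2^d$ and $\mathrm{Pdim}^*(A) = k \cdot 2^d$.
   Context: A matrix is a function $A: X \times Y \rightarrow Z$ with $Z \subseteq \mathbb{R}$ (rows indexed by $X$, columns by $Y$). A set $J \subseteq Y$ is P-shattered by $A$ if there is $\vec t: J \rightarrow \mathbb{R}$ such that for every $b: J \rightarrow \{0,1\}$ there is $x \in X$ with, for all $y \in J$, $A(x,y) \ge \vec t(y)$ iff $b(y)=1$; $J$ is V-shattered if the same holds with a single number $t \in \mathbb{R}$ in place of all $\vec t(y)$. $\mathrm{Pdim}(A)$ (resp. $\mathrm{Vdim}(A)$) is the largest size of a P-shattered (resp. V-shattered) subset of $Y$ ($\infty$ if unbounded). The transpose is $A^\top(y,x)=A(x,y)$, and $\mathrm{Pdim}^*(A) := \mathrm{Pdim}(A^\top)$, $\mathrm{Vdim}^*(A) := \mathrm{Vdim}(A^\top)$. $[n]=\{1,\ldots,n\}$. $B_D: [2^D] \times [D] \rightarrow \{0,1\}$ is a Boolean matrix whose $2^D$ rows are exactly all the distinct vectors in $\{0,1\}^D$ (unique up to permuting rows). The $B_D^\top$-based matrix with $k$ row blocks of sizes $d_1,\ldots,d_k$ (where $d_1+\cdots+d_k = D$) is obtained from $B_D^\top: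 [D] \times [2^D] \rightarrow \{0,1\}$ by partitioning the rows $[D]$ into consecutive blocks numbered $1,\ldots,k$ of sizes $d_1,\ldots,d_k$ and, in every row of block $b$, replacing each entry $1$ by $b$ and each entry $0$ by $b-1$. For a matrix $A: X \times Y \rightarrow Z$, $\dot A: (X \cup \{0\}) \times Y \rightarrow Z$ (with $0 \notin X$) denotes $A$ augmented by an extra row indexed $0$ with $\dot A(0,y) = 0$ for all $y \in Y$.
   Formalization: The thresholds $\vec t$ and $t$ of P- and V-shattering range over the rationals instead of the reals. -}

module Defs where

open import Data.Nat using (ℕ; zero; suc; _+_; _*_; _^_; _/_)
open import Data.Nat.Properties using (m^n≢0)
open import Data.Integer using (+_)
open import Data.Rational using (ℚ; 0ℚ) renaming (_/_ to _/ℚ_; _≤_ to _≤ℚ_)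
open import Data.Fin using (Fin; toℕ; zero; suc)
open import Data.Fin.Subset using (Subset; _∈_; ∣_∣)
open import Data.Bool using (Bool; true; false)
open import Data.Product using (Σ; ∃; _×_; _,_)
open import Function.Bundles using (_⇔_)
open import Relation.Binary.PropositionalEquality using (_≡_)

-- A finite real-valued matrix with rows Fin m, columns Fin n.
-- (No reals in agda-stdlib: entries and thresholds are rationals.)
Matrix : ℕ → ℕ → Set
Matrix m n = Fin m → Fin n → ℚ

ℕ→ℚ : ℕ → ℚ
ℕ→ℚ n = (+ n) /ℚ 1

transpose : ∀ {m n} → Matrix m n → Matrix n m
transpose A y x = A x y

-- J ⊆ Y is P-shattered: some thresholds t such that every labelling b of J
-- is realised by some row x (labellings of J = restrictions of b : Fin n → Bool).
PShattered : ∀ {m n} → Matrix m n → Subset n → Set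
PShattered {m} {n} A J =
  Σ (Fin n → ℚ) λ t → (b : Fin n → Bool) →
    Σ (Fin m) λ x → ∀ y → y ∈ J → (t y ≤ℚ A x y ⇔ b y ≡ true)

VShattered : ∀ {m n} → Matrix m n → Subset n → Set
VShattered {m} {n} A J =
  Σ ℚ λ t → (b : Fin n → Bool) →
    Σ (Fin m) λ x → ∀ y → y ∈ J → (t ≤ℚ A x y ⇔ b y ≡ true)

PdimIs : ∀ {m n} → Matrix m n → ℕ → Set
PdimIs {m} {n} A r =
  (Σ (Subset n) λ J → PShattered A J × ∣ J ∣ ≡ r) ×
  (∀ J → PShattered A J → ∣ J ∣ Data.Nat.≤ r)

VdimIs : ∀ {m n} → Matrix m n → ℕ → Set
VdimIs {m} {n} A r =
  (Σ (Subset n) λ J → VShattered A J × ∣ J ∣ ≡ r) ×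
  (∀ J → VShattered A J → ∣ J ∣ Data.Nat.≤ r)

PdimStarIs : ∀ {m n} → Matrix m n → ℕ → Set
PdimStarIs A r = PdimIs (transpose A) r

VdimStarIs : ∀ {m n} → Matrix m n → ℕ → Set
VdimStarIs A r = VdimIs (transpose A) r

dotted : ∀ {m n} → Matrix m n → Matrix (suc m) n
dotted A zero    y = 0ℚ
dotted A (suc x) y = A x y

IsBD : (D : ℕ) → (Fin (2 ^ D) → Fin D → Bool) → Set
IsBD D B =
  (∀ j j' → (∀ i → B j i ≡ B j' i) → j ≡ j') ×
  (∀ (v : Fin D → Bool) → Σ (Fin (2 ^ D)) λ j → ∀ i → B j i ≡ v i)

bit : Bool → ℕ
bit true  = 1
bit false = 0

-- The B_D^T-based matrix with k row blocks each of size 2^d (D = k * 2^d):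
-- row i (0-based) lies in block b = ⌊i / 2^d⌋ + 1; entry 1 ↦ b, entry 0 ↦ b - 1,
-- i.e. the entry is ⌊i / 2^d⌋ + B^T(i,j) = ⌊i / 2^d⌋ + B(j,i).
blockMatrix : (k d : ℕ) →
  (Fin (2 ^ (k * 2 ^ d)) → Fin (k * 2 ^ d) → Bool) → Matrix (k * 2 ^ d) (2 ^ (k * 2 ^ d))
blockMatrix k d B i j =
  ℕ→ℚ (_/_ (toℕ i) (2 ^ d) {{m^n≢0 2 d}} + bit (B j i))

{-# OPTIONS --safe #-}
module Submission where

-- Row i of A has all entries in {ℓ, ℓ + 1} for its level ℓ = ⌊i / 2^d⌋, and within a level it is
-- determined by i mod 2^d.  Rows are thus sorted into bands: a row that rejects some column of a
-- P-shattered set J never lies strictly above a row that accepts one, so all labellings of J taking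
-- both values are realised in one common band, by at most 2^d distinct rows.  Hence
-- 2^∣J∣ ≤ 2^d + 2, and 2^∣J∣ ≤ 2^d + 3 for Ȧ, whose zero row is one more row; for d ≥ 2 this forces
-- ∣J∣ ≤ d.  Likewise the rows V-shattered by Aᵀ lie in one band, so there are at most 2^d of them.
-- For the lower bounds read the rows of one block as the binary codes of Fin (2^d): the d columns
-- holding their bits are P-shattered, and since every 0/1 vector is a row of B_D the rows of a block are V-shattered by Aᵀ and all rows are P-shattered
-- by Aᵀ with thresholds ℓ + 1.

open import Defs
open import Data.Nat using (ℕ; zero; suc; _+_; _*_; _^_; _≤_; _<_; _/_; z≤n; NonZero)
open import Data.Nat.Properties
  using (≤-refl; ≤-reflexive; ≤-trans; ≤-antisym; ≤-pred; <-irrefl; <-≤-trans; ≰⇒>; ≮⇒≥; <⇒≱; +-comm;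
         *-comm; +-identityʳ; m≤m+n; n≤1+n; +-monoʳ-≤; +-monoˡ-<; ^-monoʳ-≤; m^n≢0; module ≤-Reasoning)
open import Data.Nat.DivMod using (m<n⇒m/n≡0; m*n/n≡m; /-congˡ; +-distrib-/-∣ʳ)
open import Data.Nat.Divisibility using (n∣m*n)
open import Data.Nat.Coprimality using (1-coprimeTo) renaming (sym to coprime-sym)
open import Data.Integer using (+_; +≤+) renaming (_≤_ to _≤ℤ_)
import Data.Integer.Properties as ℤₚ
open import Data.Rational using (ℚ; mkℚ; *≤*) renaming (_≤_ to _≤ℚ_; _<_ to _<ℚ_)
import Data.Rational.Properties as ℚₚ
open import Data.Fin using (Fin; toℕ; zero; suc; combine; quotient; remainder; fromℕ; inject₁; fromℕ<)
open import Data.Fin.Base using (finToFun; funToFin)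
open import Data.Fin.Properties
  using (_≟_; any?; suc-injective; toℕ-injective; toℕ<n; injective⇒≤; fromℕ≢inject₁;
         inject₁-injective; toℕ-combine; combine-remQuot; remQuot-combine; combine-injectiveʳ;
         funToFin-finToFin; finToFun-funToFin; 2↔Bool)
open import Data.Fin.Subset using (Subset; _∈_; ∣_∣; ⊤)
open import Data.Fin.Subset.Properties using (_∈?_; ∣p∣≤n; ∣⊤∣≡n)
open import Data.Vec using (_∷_; here; there; tabulate)
open import Data.Vec.Properties using ([]=⇒lookup; lookup⇒[]=; lookup∘tabulate)
open import Data.Bool using (Bool; true; false)
open import Data.Bool.Properties using (¬-not) renaming (_≟_ to _≟𝔹_)
open import Data.Product using (Σ; ∃; _×_; _,_; proj₁; proj₂)
open import Data.Empty using (⊥-elim)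
open import Function using (_∘_)
open import Function.Bundles using (_⇔_; mk⇔; Equivalence; Inverse)
open import Function.Definitions using (Injective)
open import Relation.Nullary using (¬_; Dec; yes; no; does)
open import Relation.Nullary.Decidable using (_×-dec_; dec-true)
open import Relation.Binary.PropositionalEquality

private variable
  m n C : ℕ

does-true⇒ : ∀ {A : Set} (a? : Dec A) → does a? ≡ true → A
does-true⇒ (yes a) _ = a

⇔≡true-unique : ∀ {A : Set} {a b : Bool} → (A ⇔ a ≡ true) → (A ⇔ b ≡ true) → a ≡ b
⇔≡true-unique {a = true}          A⇔a A⇔b = sym (Equivalence.to A⇔b (Equivalence.from A⇔a refl))
⇔≡true-unique {a = false} {false} _   _   = refl
⇔≡true-unique {a = false} {true}  A⇔a A⇔b = Equivalence.to A⇔a (Equivalence.from A⇔b refl)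

subst-⇔true : ∀ {A : Set} {a b : Bool} → a ≡ b → (A ⇔ a ≡ true) → (A ⇔ b ≡ true)
subst-⇔true refl A⇔a = A⇔a

indicator : Fin n → Fin n → Bool
indicator x y = does (y ≟ x)

indicator-self : (x : Fin n) → indicator x x ≡ true
indicator-self x = dec-true (x ≟ x) refl

indicator⇒≡ : ∀ {x y : Fin n} → indicator x y ≡ true → y ≡ x
indicator⇒≡ {x = x} {y} = does-true⇒ (y ≟ x)

ℕ→ℚ≡mkℚ : ∀ a → ℕ→ℚ a ≡ mkℚ (+ a) 0 (coprime-sym (1-coprimeTo a))
ℕ→ℚ≡mkℚ a = ℚₚ.normalize-coprime _

ℕ→ℚ-mono-≤ : ∀ {a b} → a ≤ b → ℕ→ℚ a ≤ℚ ℕ→ℚ b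
ℕ→ℚ-mono-≤ {a} {b} a≤b rewrite ℕ→ℚ≡mkℚ a | ℕ→ℚ≡mkℚ b =
  *≤* (subst₂ _≤ℤ_ (sym (ℤₚ.*-identityʳ _)) (sym (ℤₚ.*-identityʳ _)) (+≤+ a≤b))

ℕ→ℚ-cancel-≤ : ∀ {a b} → ℕ→ℚ a ≤ℚ ℕ→ℚ b → a ≤ b
ℕ→ℚ-cancel-≤ {a} {b} a≤b rewrite ℕ→ℚ≡mkℚ a | ℕ→ℚ≡mkℚ b with a≤b
... | *≤* a≤b = ℤₚ.drop‿+≤+ (subst₂ _≤ℤ_ (ℤₚ.*-identityʳ _) (ℤₚ.*-identityʳ _) a≤b)

ℕ→ℚ-cancel-< : ∀ {a b} → ℕ→ℚ a <ℚ ℕ→ℚ b → a < b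
ℕ→ℚ-cancel-< a<b = ≰⇒> λ b≤a → ℚₚ.<-irrefl refl (ℚₚ.<-≤-trans a<b (ℕ→ℚ-mono-≤ b≤a))

1+ℓ≤ℓ+bit⇔ : ∀ ℓ b → (ℕ→ℚ (suc ℓ) ≤ℚ ℕ→ℚ (ℓ + bit b) ⇔ b ≡ true)
1+ℓ≤ℓ+bit⇔ ℓ true  = mk⇔ (λ _ → refl) (λ _ → ℕ→ℚ-mono-≤ (≤-reflexive (+-comm 1 ℓ)))
1+ℓ≤ℓ+bit⇔ ℓ false =
  mk⇔ (λ 1+ℓ≤ℓ → ⊥-elim (<-irrefl (sym (+-identityʳ ℓ)) (ℕ→ℚ-cancel-≤ 1+ℓ≤ℓ))) λ ()

ℓ+bit≤1+ℓ : ∀ ℓ b → ℓ + bit b ≤ suc ℓ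
ℓ+bit≤1+ℓ ℓ true  = ≤-reflexive (+-comm ℓ 1)
ℓ+bit≤1+ℓ ℓ false = ≤-trans (≤-reflexive (+-identityʳ ℓ)) (n≤1+n ℓ)

2^s≤3+2^d⇒s≤d : ∀ {s d} → 2 ≤ d → 2 ^ s ≤ 3 + 2 ^ d → s ≤ d
2^s≤3+2^d⇒s≤d {s} {d} 2≤d 2^s≤3+2^d = ≮⇒≥ λ d<s → <⇒≱ (begin-strict
  3 + 2 ^ d      <⟨ +-monoˡ-< (2 ^ d) (^-monoʳ-≤ 2 2≤d) ⟩
  2 ^ d + 2 ^ d  ≡⟨ cong (_+_ (2 ^ d)) (+-identityʳ (2 ^ d)) ⟨
  2 ^ suc d      ≤⟨ ^-monoʳ-≤ 2 d<s ⟩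
  2 ^ s          ∎) 2^s≤3+2^d
  where open ≤-Reasoning

toℕ/n≡toℕ-quotient : ∀ n .{{_ : NonZero n}} (i : Fin (m * n)) → toℕ i / n ≡ toℕ (quotient {m} n i)
toℕ/n≡toℕ-quotient {m} n i = begin
  toℕ i / n                  ≡⟨ /-congˡ (cong toℕ (combine-remQuot {m} n i)) ⟨
  toℕ (combine q r) / n      ≡⟨ /-congˡ (toℕ-combine q r) ⟩
  (n * toℕ q + toℕ r) / n    ≡⟨ /-congˡ (trans (+-comm (n * toℕ q) (toℕ r))
                                                 (cong (_+_ (toℕ r)) (*-comm n (toℕ q)))) ⟩
  (toℕ r + toℕ q * n) / n    ≡⟨ +-distrib-/-∣ʳ (toℕ r) (n∣m*n (toℕ q)) ⟩
  toℕ r / n + toℕ q * n / n  ≡⟨ cong₂ _+_ (m<n⇒m/n≡0 (toℕ<n r)) (m*n/n≡m (toℕ q) n) ⟩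
  toℕ q                      ∎
  where
  open ≡-Reasoning
  q = quotient {m} n i
  r = remainder {m} n i

/-remainder-injective : ∀ n .{{_ : NonZero n}} {i j : Fin (m * n)} →
  toℕ i / n ≡ toℕ j / n → remainder {m} n i ≡ remainder {m} n j → i ≡ j
/-remainder-injective {m} n {i} {j} same-quotient same-remainder = begin
  i                                               ≡⟨ combine-remQuot {m} n i ⟨
  combine (quotient {m} n i) (remainder {m} n i)  ≡⟨ cong₂ combine quotients same-remainder ⟩
  combine (quotient {m} n j) (remainder {m} n j)  ≡⟨ combine-remQuot {m} n j ⟩
  j                                               ∎
  where
  open ≡-Reasoning
  quotients : quotient {m} n i ≡ quotient {m} n j
  quotients = toℕ-injective
    (trans (sym (toℕ/n≡toℕ-quotient {m} n i)) (trans same-quotient (toℕ/n≡toℕ-quotient {m} n j)))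

funToFin-cong : {f g : Fin m → Fin n} → (∀ i → f i ≡ g i) → funToFin f ≡ funToFin g
funToFin-cong {zero}  _    = refl
funToFin-cong {suc m} f≗g = cong₂ combine (f≗g zero) (funToFin-cong (f≗g ∘ suc))

module Bits = Inverse 2↔Bool

toBool-injective : Injective _≡_ _≡_ Bits.to
toBool-injective {i} {j} eq =
  trans (sym (Bits.strictlyInverseʳ i)) (trans (cong Bits.from eq) (Bits.strictlyInverseʳ j))

enum : (p : Subset n) → Fin ∣ p ∣ → Fin n
enum (false ∷ p) i       = suc (enum p i)
enum (true  ∷ p) zero    = zero
enum (true  ∷ p) (suc i) = suc (enum p i)

enum-∈ : (p : Subset n) (i : Fin ∣ p ∣) → enum p i ∈ p
enum-∈ (false ∷ p) i       = there (enum-∈ p i)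
enum-∈ (true  ∷ p) zero    = here
enum-∈ (true  ∷ p) (suc i) = there (enum-∈ p i)

enum-injective : (p : Subset n) → Injective _≡_ _≡_ (enum p)
enum-injective (false ∷ p) {i}     {j}     eq = enum-injective p (suc-injective eq)
enum-injective (true  ∷ p) {zero}  {zero}  _  = refl
enum-injective (true  ∷ p) {suc i} {suc j} eq = cong suc (enum-injective p (suc-injective eq))

index : ∀ {p : Subset n} {x} → x ∈ p → Fin ∣ p ∣
index {p = true  ∷ p} here        = zero
index {p = false ∷ p} (there x∈p) = index x∈p
index {p = true  ∷ p} (there x∈p) = suc (index x∈p)

enum-index : ∀ {p : Subset n} {x} (x∈p : x ∈ p) → enum p (index x∈p) ≡ x
enum-index {p = true  ∷ p} here        = refl
enum-index {p = false ∷ p} (there x∈p) = cong suc (enum-index x∈p)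
enum-index {p = true  ∷ p} (there x∈p) = cong suc (enum-index x∈p)

∣p∣≤-injective : (p : Subset n) (f : ∀ {x} → x ∈ p → Fin m) →
  (∀ {x y} (x∈p : x ∈ p) (y∈p : y ∈ p) → f x∈p ≡ f y∈p → x ≡ y) → ∣ p ∣ ≤ m
∣p∣≤-injective p f inj = injective⇒≤ (enum-injective p ∘ inj (enum-∈ p _) (enum-∈ p _))

≤∣p∣-injective : (p : Subset n) (g : Fin m → Fin n) → Injective _≡_ _≡_ g →
  (∀ a → g a ∈ p) → m ≤ ∣ p ∣
≤∣p∣-injective p g inj g∈p = injective⇒≤ λ {a} {b} eq → inj (begin
  g a                     ≡⟨ enum-index (g∈p a) ⟨
  enum p (index (g∈p a))  ≡⟨ cong (enum p) eq ⟩
  enum p (index (g∈p b))  ≡⟨ enum-index (g∈p b) ⟩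
  g b                     ∎)
  where open ≡-Reasoning

image : (Fin m → Fin n) → Subset n
image f = tabulate λ y → does (any? λ a → f a ≟ y)

∈-image⁺ : (f : Fin m → Fin n) (a : Fin m) → f a ∈ image f
∈-image⁺ f a =
  lookup⇒[]= (f a) (image f) (trans (lookup∘tabulate _ (f a)) (dec-true (any? _) (a , refl)))

∈-image⁻ : (f : Fin m → Fin n) {y : Fin n} → y ∈ image f → ∃ λ a → f a ≡ y
∈-image⁻ f {y} y∈f = does-true⇒ (any? _) (trans (sym (lookup∘tabulate _ y)) ([]=⇒lookup y∈f))

injective⇒∣image∣≡ : {f : Fin m → Fin n} → Injective _≡_ _≡_ f → ∣ image f ∣ ≡ m
injective⇒∣image∣≡ {f = f} inj = ≤-antisym
  (∣p∣≤-injective (image f) (proj₁ ∘ ∈-image⁻ f) λ x∈f y∈f eq →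
    trans (sym (proj₂ (∈-image⁻ f x∈f))) (trans (cong f eq) (proj₂ (∈-image⁻ f y∈f))))
  (≤∣p∣-injective (image f) f inj (∈-image⁺ f))

spread : (p : Subset n) → (Fin ∣ p ∣ → Bool) → Fin n → Bool
spread (false ∷ p) c zero    = false
spread (false ∷ p) c (suc y) = spread p c y
spread (true  ∷ p) c zero    = c zero
spread (true  ∷ p) c (suc y) = spread p (c ∘ suc) y

spread-enum : (p : Subset n) (c : Fin ∣ p ∣ → Bool) (i : Fin ∣ p ∣) → spread p c (enum p i) ≡ c i
spread-enum (false ∷ p) c i       = spread-enum p c i
spread-enum (true  ∷ p) c zero    = refl
spread-enum (true  ∷ p) c (suc i) = spread-enum p (c ∘ suc) i

labelling : (p : Subset n) → Fin (2 ^ ∣ p ∣) → Fin n → Bool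
labelling p a = spread p (Bits.to ∘ finToFun a)

labelling-injective : (p : Subset n) {a b : Fin (2 ^ ∣ p ∣)} →
  (∀ {y} → y ∈ p → labelling p a y ≡ labelling p b y) → a ≡ b
labelling-injective p {a} {b} agree = begin
  a                                  ≡⟨ funToFin-finToFin {∣ p ∣} {2} a ⟨
  funToFin (finToFun {2} {∣ p ∣} a)  ≡⟨ funToFin-cong (toBool-injective ∘ bits-agree) ⟩
  funToFin (finToFun {2} {∣ p ∣} b)  ≡⟨ funToFin-finToFin {∣ p ∣} {2} b ⟩
  b                                  ∎
  where
  open ≡-Reasoning
  bits-agree : ∀ i → Bits.to (finToFun a i) ≡ Bits.to (finToFun b i)
  bits-agree i = begin
    Bits.to (finToFun a i)    ≡⟨ spread-enum p _ i ⟨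
    labelling p a (enum p i)  ≡⟨ agree (enum-∈ p i) ⟩
    labelling p b (enum p i)  ≡⟨ spread-enum p _ i ⟩
    Bits.to (finToFun b i)    ∎

data Kind (p : Subset n) (b : Fin n → Bool) : Set where
  constant : ∀ v → (∀ {y} → y ∈ p → b y ≡ v) → Kind p b
  mixed    : ∀ {y y′} → y ∈ p → b y ≡ true → y′ ∈ p → b y′ ≡ false → Kind p b

kind : (p : Subset n) (b : Fin n → Bool) → Kind p b
kind p b with any? (λ y → y ∈? p ×-dec b y ≟𝔹 true) | any? (λ y → y ∈? p ×-dec b y ≟𝔹 false)
... | yes (y , y∈p , by) | yes (y′ , y′∈p , by′) = mixed y∈p by y′∈p by′
... | no ¬true  | _         = constant false λ {y} y∈p → ¬-not λ by → ¬true (y , y∈p , by)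
... | yes _     | no ¬false = constant true λ {y} y∈p → ¬-not λ by → ¬false (y , y∈p , by)

record Banded (M : Matrix m n) (C : ℕ) : Set where
  field
    level          : Fin m → ℕ
    level≤entry    : ∀ x y → ℕ→ℚ (level x) ≤ℚ M x y
    entry≤1+level  : ∀ x y → M x y ≤ℚ ℕ→ℚ (suc (level x))
    code           : Fin m → Fin C
    row-determined : ∀ {x x′} → level x ≡ level x′ → code x ≡ code x′ → ∀ y → M x y ≡ M x′ y

  level<⇒entry≤ : ∀ {x x′} → level x < level x′ → ∀ y y′ → M x y ≤ℚ M x′ y′
  level<⇒entry≤ {x} {x′} x<x′ y y′ =
    ℚₚ.≤-trans (entry≤1+level x y) (ℚₚ.≤-trans (ℕ→ℚ-mono-≤ x<x′) (level≤entry x′ y′))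

  entry<⇒level≤ : ∀ {x x′ y y′} → M x y <ℚ M x′ y′ → level x ≤ level x′
  entry<⇒level≤ {x} {x′} {y} {y′} M<M′ = ≤-pred (ℕ→ℚ-cancel-<
    (ℚₚ.≤-<-trans (level≤entry x y) (ℚₚ.<-≤-trans M<M′ (entry≤1+level x′ y′))))

dotted-banded : {M : Matrix m n} → Banded M C → Banded (dotted M) (suc C)
dotted-banded {m} {n} {C} {M} banded = record
  { level          = levelᵒ
  ; level≤entry    = λ { zero _ → ℚₚ.≤-refl ; (suc x) → level≤entry x }
  ; entry≤1+level  = λ { zero _ → ℕ→ℚ-mono-≤ {b = 1} z≤n ; (suc x) → entry≤1+level x }
  ; code           = codeᵒ
  ; row-determined = λ {x} {x′} → determined {x} {x′}
  }
  where
  open Banded banded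
  levelᵒ : Fin (suc m) → ℕ
  levelᵒ zero    = 0
  levelᵒ (suc x) = level x
  codeᵒ : Fin (suc m) → Fin (suc C)
  codeᵒ zero    = fromℕ C
  codeᵒ (suc x) = inject₁ (code x)
  determined : ∀ {x x′} → levelᵒ x ≡ levelᵒ x′ → codeᵒ x ≡ codeᵒ x′ →
    ∀ y → dotted M x y ≡ dotted M x′ y
  determined {zero}  {zero}   _ _  _ = refl
  determined {zero}  {suc x′} _ eq _ = ⊥-elim (fromℕ≢inject₁ eq)
  determined {suc x} {zero}   _ eq _ = ⊥-elim (fromℕ≢inject₁ (sym eq))
  determined {suc x} {suc x′} same-level eq = row-determined same-level (inject₁-injective eq)

module PShattering {M : Matrix m n} (banded : Banded M C) {J : Subset n} (t : Fin n → ℚ)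
  (realise : (b : Fin n → Bool) → Σ (Fin m) λ x → ∀ y → y ∈ J → (t y ≤ℚ M x y ⇔ b y ≡ true)) where
  open Banded banded

  realiser : (Fin n → Bool) → Fin m
  realiser b = proj₁ (realise b)

  realises : ∀ b {y} → y ∈ J → (t y ≤ℚ M (realiser b) y ⇔ b y ≡ true)
  realises b {y} = proj₂ (realise b) y

  rejects : ∀ b {y} → y ∈ J → b y ≡ false → ¬ (t y ≤ℚ M (realiser b) y)
  rejects b y∈J by accept with trans (sym by) (Equivalence.to (realises b y∈J) accept)
  ... | ()

  -- The realiser z of the labelling that accepts y′ alone lies at least as high as x′, so if x lay
  -- below x′ then z would accept y as well.
  rejecting-level≤accepting-level : ∀ {x x′ y y′} → y ∈ J → t y ≤ℚ M x y →
    y′ ∈ J → ¬ (t y′ ≤ℚ M x′ y′) → level x′ ≤ level x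
  rejecting-level≤accepting-level {x} {x′} {y} {y′} y∈J accept y′∈J reject = ≮⇒≥ ¬x<x′
    where
    z : Fin m
    z = realiser (indicator y′)
    x′≤z : level x′ ≤ level z
    x′≤z = entry<⇒level≤ (ℚₚ.<-≤-trans (ℚₚ.≰⇒> reject)
      (Equivalence.from (realises (indicator y′) y′∈J) (indicator-self y′)))
    ¬x<x′ : ¬ level x < level x′
    ¬x<x′ x<x′ =
      reject (subst (λ w → t w ≤ℚ M x′ w) y≡y′ (ℚₚ.≤-trans accept (level<⇒entry≤ x<x′ y y)))
      where
      y≡y′ : y ≡ y′
      y≡y′ = indicator⇒≡ (Equivalence.to (realises (indicator y′) y∈J)
        (ℚₚ.≤-trans accept (level<⇒entry≤ (<-≤-trans x<x′ x′≤z) y y)))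

  mixed-level≤ : ∀ {b b′ y y′} → y ∈ J → b y ≡ true → y′ ∈ J → b′ y′ ≡ false →
    level (realiser b′) ≤ level (realiser b)
  mixed-level≤ {b} {b′} y∈J by y′∈J by′ = rejecting-level≤accepting-level
    y∈J (Equivalence.from (realises b y∈J) by) y′∈J (rejects b′ y′∈J by′)

  class : ∀ {b} → Kind J b → Fin (2 + C)
  class (constant false _)  = zero
  class (constant true _)   = suc zero
  class {b} (mixed _ _ _ _) = suc (suc (code (realiser b)))

  class-injective : ∀ {b b′} (κ : Kind J b) (κ′ : Kind J b′) → class κ ≡ class κ′ →
    ∀ {y} → y ∈ J → b y ≡ b′ y
  class-injective (constant false f) (constant false f′) _ y∈J = trans (f y∈J) (sym (f′ y∈J))
  class-injective (constant true f)  (constant true f′)  _ y∈J = trans (f y∈J) (sym (f′ y∈J))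
  class-injective (constant false _) (constant true _)  ()
  class-injective (constant true _)  (constant false _) ()
  class-injective (constant false _) (mixed _ _ _ _)    ()
  class-injective (constant true _)  (mixed _ _ _ _)    ()
  class-injective (mixed _ _ _ _)    (constant false _) ()
  class-injective (mixed _ _ _ _)    (constant true _)  ()
  class-injective {b} {b′} (mixed y₁ t₁ y₂ f₂) (mixed y₁′ t₁′ y₂′ f₂′) eq {y} y∈J =
    ⇔≡true-unique (realises b y∈J)
      (subst (λ v → t y ≤ℚ v ⇔ b′ y ≡ true) (sym same-entry) (realises b′ y∈J))
    where
    same-level : level (realiser b) ≡ level (realiser b′)
    same-level = ≤-antisym (mixed-level≤ y₁′ t₁′ y₂ f₂) (mixed-level≤ y₁ t₁ y₂′ f₂′)
    same-entry : M (realiser b) y ≡ M (realiser b′) y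
    same-entry = row-determined same-level (suc-injective (suc-injective eq)) y

  2^∣J∣≤2+C : 2 ^ ∣ J ∣ ≤ 2 + C
  2^∣J∣≤2+C = injective⇒≤ {f = λ a → class (kind J (labelling J a))} λ eq →
    labelling-injective J (class-injective (kind J _) (kind J _) eq)

module VShatteringᵀ {M : Matrix m n} (banded : Banded M C) {J : Subset m} (t : ℚ)
  (realise : (b : Fin m → Bool) → Σ (Fin n) λ y → ∀ x → x ∈ J → (t ≤ℚ M x y ⇔ b x ≡ true)) where
  open Banded banded

  column : Fin m → Fin n
  column x = proj₁ (realise (indicator x))

  accepts-column⇒≡ : ∀ {x x′} → x ∈ J → t ≤ℚ M x (column x′) → x ≡ x′
  accepts-column⇒≡ {x} {x′} x∈J accept =
    indicator⇒≡ (Equivalence.to (proj₂ (realise (indicator x′)) x x∈J) accept)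

  accepts-own-column : ∀ {x} → x ∈ J → t ≤ℚ M x (column x)
  accepts-own-column {x} x∈J = Equivalence.from (proj₂ (realise (indicator x)) x x∈J) (indicator-self x)

  level-≤ : ∀ {x x′} → x ∈ J → x′ ∈ J → level x ≤ level x′
  level-≤ {x} {x′} x∈J x′∈J = ≮⇒≥ λ x′<x → <-irrefl (cong level (sym
    (accepts-column⇒≡ x∈J (ℚₚ.≤-trans (accepts-own-column x′∈J) (level<⇒entry≤ x′<x _ _))))) x′<x

  ∣J∣≤C : ∣ J ∣ ≤ C
  ∣J∣≤C = ∣p∣≤-injective J (λ {x} _ → code x) λ {x} {x′} x∈J x′∈J same-code →
    accepts-column⇒≡ x∈J (subst (t ≤ℚ_)
      (sym (row-determined (≤-antisym (level-≤ x∈J x′∈J) (level-≤ x′∈J x∈J)) same-code (column x′)))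
      (accepts-own-column x′∈J))

PShattered⇒2^∣J∣≤2+C : {M : Matrix m n} → Banded M C → ∀ J → PShattered M J → 2 ^ ∣ J ∣ ≤ 2 + C
PShattered⇒2^∣J∣≤2+C banded J (t , realise) = PShattering.2^∣J∣≤2+C banded t realise

VShatteredᵀ⇒∣J∣≤C : {M : Matrix m n} → Banded M C → ∀ J → VShattered (transpose M) J → ∣ J ∣ ≤ C
VShatteredᵀ⇒∣J∣≤C banded J (t , realise) = VShatteringᵀ.∣J∣≤C banded t realise

banded⇒∣J∣≤d : ∀ {d} {M : Matrix m n} → 2 ≤ d → Banded M C → C ≤ suc (2 ^ d) →
  ∀ J → PShattered M J → ∣ J ∣ ≤ d
banded⇒∣J∣≤d 2≤d banded C≤1+2^d J shattered =
  2^s≤3+2^d⇒s≤d 2≤d (≤-trans (PShattered⇒2^∣J∣≤2+C banded J shattered) (+-monoʳ-≤ 2 C≤1+2^d))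

module BlockMatrix (k d : ℕ) (B : Fin (2 ^ (k * 2 ^ d)) → Fin (k * 2 ^ d) → Bool) where
  private instance
    2^d≢0 : NonZero (2 ^ d)
    2^d≢0 = m^n≢0 2 d

  A : Matrix (k * 2 ^ d) (2 ^ (k * 2 ^ d))
  A = blockMatrix k d B

  HasAllRows : Set
  HasAllRows = ∀ (v : Fin (k * 2 ^ d) → Bool) → Σ (Fin (2 ^ (k * 2 ^ d))) λ j → ∀ i → B j i ≡ v i

  level : Fin (k * 2 ^ d) → ℕ
  level i = toℕ i / 2 ^ d

  1+level≤entry⇔ : ∀ i j → (ℕ→ℚ (suc (level i)) ≤ℚ A i j ⇔ B j i ≡ true)
  1+level≤entry⇔ i j = 1+ℓ≤ℓ+bit⇔ (level i) (B j i)

  banded : Banded A (2 ^ d)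
  banded = record
    { level          = level
    ; level≤entry    = λ i j → ℕ→ℚ-mono-≤ (m≤m+n (level i) (bit (B j i)))
    ; entry≤1+level  = λ i j → ℕ→ℚ-mono-≤ (ℓ+bit≤1+ℓ (level i) (B j i))
    ; code           = remainder {k} (2 ^ d)
    ; row-determined = λ same-level same-code j →
        cong (λ i → A i j) (/-remainder-injective {k} (2 ^ d) same-level same-code)
    }

  all-rows-PShatteredᵀ : HasAllRows → PShattered (transpose A) ⊤
  all-rows-PShatteredᵀ allRows = (λ i → ℕ→ℚ (suc (level i))) , λ b → proj₁ (allRows b) ,
    λ i _ → subst-⇔true (proj₂ (allRows b) i) (1+level≤entry⇔ i (proj₁ (allRows b)))

  module Block (blk : Fin k) (allRows : HasAllRows) where
    row : Fin (2 ^ d) → Fin (k * 2 ^ d)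
    row = combine blk

    row-injective : Injective _≡_ _≡_ row
    row-injective = combine-injectiveʳ blk _ blk _

    level-row : ∀ r → level (row r) ≡ toℕ blk
    level-row r =
      trans (toℕ/n≡toℕ-quotient (2 ^ d) (row r)) (cong (toℕ ∘ proj₁) (remQuot-combine blk r))

    row-threshold : ∀ r j → (ℕ→ℚ (suc (toℕ blk)) ≤ℚ A (row r) j ⇔ B j (row r) ≡ true)
    row-threshold r j =
      subst (λ ℓ → ℕ→ℚ (suc ℓ) ≤ℚ A (row r) j ⇔ B j (row r) ≡ true) (level-row r)
        (1+level≤entry⇔ (row r) j)

    bitColumn : Fin d → Fin (2 ^ (k * 2 ^ d))
    bitColumn m = proj₁ (allRows λ i → Bits.to (finToFun (remainder {k} (2 ^ d) i) m))

    rowFor : (Fin d → Bool) → Fin (k * 2 ^ d)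
    rowFor c = row (funToFin (Bits.from ∘ c))

    bitColumn-rowFor : ∀ c m → B (bitColumn m) (rowFor c) ≡ c m
    bitColumn-rowFor c m = begin
      B (bitColumn m) (rowFor c)
        ≡⟨ proj₂ (allRows _) (rowFor c) ⟩
      Bits.to (finToFun (remainder {k} (2 ^ d) (rowFor c)) m)
        ≡⟨ cong (λ r → Bits.to (finToFun r m)) (cong proj₂ (remQuot-combine blk _)) ⟩
      Bits.to (finToFun (funToFin (Bits.from ∘ c)) m)
        ≡⟨ cong Bits.to (finToFun-funToFin (Bits.from ∘ c) m) ⟩
      Bits.to (Bits.from (c m))
        ≡⟨ Bits.strictlyInverseˡ (c m) ⟩
      c m
        ∎
      where open ≡-Reasoning

    bitColumn-injective : Injective _≡_ _≡_ bitColumn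
    bitColumn-injective {m} {m′} eq = sym (indicator⇒≡ (begin
      indicator m m′                           ≡⟨ bitColumn-rowFor (indicator m) m′ ⟨
      B (bitColumn m′) (rowFor (indicator m))  ≡⟨ cong (λ j → B j (rowFor (indicator m))) eq ⟨
      B (bitColumn m) (rowFor (indicator m))   ≡⟨ bitColumn-rowFor (indicator m) m ⟩
      indicator m m                            ≡⟨ indicator-self m ⟩
      true                                     ∎))
      where open ≡-Reasoning

    bitColumns-realised : ∀ b {y} → y ∈ image bitColumn →
      (ℕ→ℚ (suc (toℕ blk)) ≤ℚ A (rowFor (b ∘ bitColumn)) y ⇔ b y ≡ true)
    bitColumns-realised b y∈J with ∈-image⁻ bitColumn y∈J
    ... | m , refl = subst-⇔true (bitColumn-rowFor (b ∘ bitColumn) m) (row-threshold _ (bitColumn m))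

    bitColumns-PShattered : PShattered A (image bitColumn)
    bitColumns-PShattered =
      (λ _ → ℕ→ℚ (suc (toℕ blk))) , λ b → rowFor (b ∘ bitColumn) , λ _ → bitColumns-realised b

    bitColumns-PShattered-dotted : PShattered (dotted A) (image bitColumn)
    bitColumns-PShattered-dotted =
      (λ _ → ℕ→ℚ (suc (toℕ blk))) , λ b → suc (rowFor (b ∘ bitColumn)) , λ _ → bitColumns-realised b

    rows-realised : ∀ b {i} → i ∈ image row →
      (ℕ→ℚ (suc (toℕ blk)) ≤ℚ A i (proj₁ (allRows b)) ⇔ b i ≡ true)
    rows-realised b i∈J with ∈-image⁻ row i∈J
    ... | r , refl = subst-⇔true (proj₂ (allRows b) (row r)) (row-threshold r _)

    rows-VShatteredᵀ : VShattered (transpose A) (image row)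
    rows-VShatteredᵀ = ℕ→ℚ (suc (toℕ blk)) , λ b → proj₁ (allRows b) , λ _ → rows-realised b

lemma2 : (d k : ℕ) → 2 ≤ d → 1 ≤ k →
    (B : Fin (2 ^ (k * 2 ^ d)) → Fin (k * 2 ^ d) → Bool) → IsBD (k * 2 ^ d) B →
    PdimIs (blockMatrix k d B) d ×
    PdimIs (dotted (blockMatrix k d B)) d ×
    VdimStarIs (blockMatrix k d B) (2 ^ d) ×
    PdimStarIs (blockMatrix k d B) (k * 2 ^ d)
lemma2 d k 2≤d 1≤k B (_ , allRows) =
    ((image bitColumn , bitColumns-PShattered , injective⇒∣image∣≡ bitColumn-injective) ,
      banded⇒∣J∣≤d 2≤d banded (n≤1+n _))
  , ((image bitColumn , bitColumns-PShattered-dotted , injective⇒∣image∣≡ bitColumn-injective) ,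
      banded⇒∣J∣≤d 2≤d (dotted-banded banded) ≤-refl)
  , ((image row , rows-VShatteredᵀ , injective⇒∣image∣≡ row-injective) , VShatteredᵀ⇒∣J∣≤C banded)
  , ((⊤ , all-rows-PShatteredᵀ allRows , ∣⊤∣≡n _) , λ J _ → ∣p∣≤n J)
  where
  open BlockMatrix k d B
  open Block (fromℕ< 1≤k) allRows
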